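{- Let $a,b$ be integers and $f(x)=(x-a)(x-b)$. If $n$ is a Frobenius pseudoprime with respect to $f(x)$, then $n$ is a pseudoprime to the base $a$ and a pseudoprime to the base $b$.
   Context: A pseudoprime to the base $a$ is a composite $n$ with $a^{n-1}\equiv 1\pmod n$. For monic polynomials $g_1,g_2$ over a commutative ring $R$ with identity, a monic $h\in R[x]$ is $\operatorname{gcmd}(g_1,g_2)$ if the ideal generated by $g_1,g_2$ equals the ideal generated by $h$ (it may fail to exist). Let $f(x)\in\mathbb{Z}[x]$ be monic of degree $d$ with discriminant $\Delta$. An odd integer $n>1$ is a Frobenius probable prime with respect to $f$ if $\gcd(n,f(0)\Delta)=1$ and, with all computations in $(\mathbb{Z}/n\mathbb{Z})[x]$: (Factorization) setting $f_0=f\bmod n$ and, for $1\le i\le d$, $F_i=\operatorname{gcmd}(x^{n^i}-x,f_{i-1})$ and $f_i=f_{i-1}/F_i$, all these gcmds exist and $f_d=1$; (Frobenius) for $2\le i\le d$, $F_i(x^n)\equiv 0\pmod{F_i(x)}$; (Jacobi) with $S=\sum_{2\mid i}\deg(F_i)/i$, one has $(-1)^S=\left(\frac{\Delta}{n}\right)$ (Jacobi symbol). A Frobenius pseudoprime with respect to $f$ is a composite Frobenius probable prime with respect to $f$. -}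

module Defs where

open import Data.Nat as ℕ using (ℕ; zero; suc; _≤_; _<_; NonZero)
open import Data.Nat.GCD using (gcd)
open import Data.Nat.Primality using (Prime; Composite)
open import Data.Integer as ℤ using (ℤ; +_; -_; _-_; ∣_∣)
open import Data.Integer.Divisibility using (_∣_)
open import Data.List as List using (List; []; _∷_; _++_; replicate; length)
open import Data.Vec as Vec using (Vec)
open import Data.Product using (Σ; ∃; ∃-syntax; _×_; _,_)
open import Data.Empty using (⊥)
open import Data.Unit using (⊤)
import Data.Nat.Divisibility as ℕDiv
open import Relation.Binary.PropositionalEquality using (_≡_)
open import Relation.Nullary using (¬_)

_≡_[mod_] : ℤ → ℤ → ℕ → Set
x ≡ y [mod n ] = (+ n) ∣ (x - y)

-- Polynomials with integer coefficients, as coefficient lists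
-- (constant term first).  A polynomial over ℤ/nℤ is represented by any
-- integer lift; equality in (ℤ/nℤ)[x] is coefficientwise congruence.

Poly : Set
Poly = List ℤ

coeff : Poly → ℕ → ℤ
coeff []       _       = + 0
coeff (c ∷ p)  zero    = c
coeff (c ∷ p)  (suc k) = coeff p k

_≈_[modP_] : Poly → Poly → ℕ → Set
p ≈ q [modP n ] = ∀ k → coeff p k ≡ coeff q k [mod n ]

infix 4 _≈_[modP_] _≡_[mod_]
infixl 8 _∘P_
infixl 6 _⊕_
infixl 7 _⊛_ _·_

_⊕_ : Poly → Poly → Poly
[]      ⊕ q       = q
p       ⊕ []      = p
(a ∷ p) ⊕ (b ∷ q) = (a ℤ.+ b) ∷ (p ⊕ q)

_·_ : ℤ → Poly → Poly
c · p = List.map (c ℤ.*_) p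

_⊛_ : Poly → Poly → Poly
[]      ⊛ q = []
(a ∷ p) ⊛ q = (a · q) ⊕ (+ 0 ∷ (p ⊛ q))

⊝_ : Poly → Poly
⊝ p = (- + 1) · p

X^ : ℕ → Poly
X^ k = replicate k (+ 0) ++ (+ 1 ∷ [])

_∘P_ : Poly → Poly → Poly
p ∘P q = List.foldr (λ c acc → (c ∷ []) ⊕ (q ⊛ acc)) [] p

-- Monic polynomials of degree k: the vector holds the coefficients of
-- x^0 … x^(k-1); the leading coefficient 1 (of x^k) is implicit.
-- Hence the degree of a monic polynomial is the index k.

Monic : ℕ → Set
Monic k = Vec ℤ k

toPoly : ∀ {k} → Monic k → Poly
toPoly c = Vec.toList c ++ (+ 1 ∷ [])

IsGCMD : ℕ → Poly → Poly → Poly → Set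
IsGCMD n g₁ g₂ h =
    (∃[ u ] ∃[ v ] (h ≈ u ⊛ g₁ ⊕ v ⊛ g₂ [modP n ]))
  × (∃[ s ] (g₁ ≈ s ⊛ h [modP n ]))
  × (∃[ t ] (g₂ ≈ t ⊛ h [modP n ]))

MonicPoly : Set
MonicPoly = Σ ℕ Monic

deg : MonicPoly → ℕ
deg (k , _) = k

-- The factorization chain, starting at step i with current f_{i-1} = g
-- (monic of degree k), and the list Fs = F_i , F_{i+1} , … , F_d.
-- F_i = gcmd(x^{n^i} - x , f_{i-1}),  f_i = f_{i-1} / F_i
-- (i.e. f_{i-1} = F_i · f_i in (ℤ/nℤ)[x], f_i monic), and at the end f_d = 1.
FactorChain : (n i k : ℕ) → Monic k → List MonicPoly → Set
FactorChain n i k g [] = k ≡ 0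
FactorChain n i k g ((m , F) ∷ Fs) =
    IsGCMD n (X^ (n ℕ.^ i) ⊕ ⊝ X^ 1) (toPoly g) (toPoly F)
  × (Σ ℕ λ k′ → Σ (Monic k′) λ g′ →
       (toPoly g ≈ toPoly F ⊛ toPoly g′ [modP n ])
     × FactorChain n (suc i) k′ g′ Fs)

-- Frobenius step condition: F_i(x^n) ≡ 0 (mod F_i(x)) for 2 ≤ i ≤ d.
-- The list Fs starts with F_i.
FrobeniusCond : (n i : ℕ) → List MonicPoly → Set
FrobeniusCond n i [] = ⊤
FrobeniusCond n i ((m , F) ∷ Fs) =
    (2 ≤ i → ∃[ q ] (toPoly F ∘P X^ n ≈ q ⊛ toPoly F [modP n ]))
  × FrobeniusCond n (suc i) Fs

-- S = Σ_{i even} deg(F_i) / i.  Here Ssum i′ Fs has Fs starting with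
-- F_i where i = suc i′ (so the division is by a nonzero number).
Ssum : (i′ : ℕ) → List MonicPoly → ℕ
Ssum i′ [] = 0
Ssum i′ (F ∷ Fs) with suc i′ ℕ.% 2
... | zero  = deg F ℕ./ suc i′ ℕ.+ Ssum (suc i′) Fs
... | suc _ = Ssum (suc i′) Fs

data Legendre (a : ℤ) (p : ℕ) : ℤ → Set where
  leg-zero : (+ p) ∣ a → Legendre a p (+ 0)
  leg-res  : ¬ ((+ p) ∣ a) → (∃[ y ] (y ℤ.* y ≡ a [mod p ])) → Legendre a p (+ 1)
  leg-non  : ¬ (∃[ y ] (y ℤ.* y ≡ a [mod p ])) → Legendre a p (- + 1)

data Jacobi (a : ℤ) : ℕ → ℤ → Set where
  jac-one  : Jacobi a 1 (+ 1)
  jac-step : ∀ {p m l j} → Prime p → ¬ (p ≡ 2) →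
             Legendre a p l → Jacobi a m j → Jacobi a (p ℕ.* m) (l ℤ.* j)

-- Frobenius probable primes with respect to a monic f ∈ ℤ[x] of degree d
-- with discriminant Δ (Δ supplied as the discriminant of f).

FrobeniusProbablePrime : (d : ℕ) → Monic d → (Δ : ℤ) → ℕ → Set
FrobeniusProbablePrime d f Δ n =
    ¬ (2 ℕDiv.∣ n)
  × 1 < n
  × gcd n ∣ coeff (toPoly f) 0 ℤ.* Δ ∣ ≡ 1
  × (Σ (List MonicPoly) λ Fs →
        length Fs ≡ d
      × FactorChain n 1 d f Fs
      × FrobeniusCond n 1 Fs
      × Jacobi Δ n ((- + 1) ℤ.^ Ssum 0 Fs))

FrobeniusPseudoprime : (d : ℕ) → Monic d → (Δ : ℤ) → ℕ → Set
FrobeniusPseudoprime d f Δ n = Composite n × FrobeniusProbablePrime d f Δ n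

Pseudoprime : ℤ → ℕ → Set
Pseudoprime a n = Composite n × (a ℤ.^ (n ℕ.∸ 1) ≡ + 1 [mod n ])

disc₂ : Monic 2 → ℤ
disc₂ (c₀ Vec.∷ c₁ Vec.∷ Vec.[]) = c₁ ℤ.* c₁ - + 4 ℤ.* c₀

-- (x - a)(x - b) = x² - (a + b) x + a b
linProd : ℤ → ℤ → Monic 2
linProd a b = (a ℤ.* b) Vec.∷ (- (a ℤ.+ b)) Vec.∷ Vec.[]

{-# OPTIONS --safe #-}
module Submission where

open import Defs
open import Data.Nat using (ℕ)
open import Data.Integer using (ℤ)
open import Data.Product using (_×_)

open import Data.Empty using (⊥-elim)
open import Data.Integer using (+_; -_; _+_; _*_; _-_; _^_; ∣_∣)
import Data.Integer.Divisibility.Signed as Signed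
import Data.Integer.Properties as ℤ
open import Algebra.Properties.CommutativeSemigroup ℤ.+-commutativeSemigroup using (interchange)
open import Algebra.Properties.CommutativeSemigroup ℤ.*-commutativeSemigroup using (x∙yz≈y∙xz)
open import Data.Integer.Tactic.RingSolver using (solve-∀)
open import Data.List using (List; []; _∷_; map)
open import Data.Nat as ℕ using (zero; suc; _<_; z<s; s<s)
open import Data.Nat.Coprimality using (Coprime; gcd≡1⇒coprime; coprime-divisor)
import Data.Nat.Divisibility as ℕ
open import Data.Nat.GCD using (gcd)
open import Data.Nat.ListAction using (sum)
open import Data.Nat.Primality using (Prime; ¬prime[1])
import Data.Nat.Properties as ℕ
open import Data.Product using (_,_; proj₁; proj₂)
open import Data.Vec using ([]; _∷_)
open import Function using (_∘_)
open import Level using (0ℓ)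
open import Relation.Binary.Bundles using (Setoid)
open import Relation.Binary.Definitions using (tri<; tri≈; tri>)
open import Relation.Binary.PropositionalEquality
  using (_≡_; refl; sym; trans; cong; cong₂; subst; subst₂; module ≡-Reasoning)
import Relation.Binary.Reasoning.Setoid
open import Relation.Nullary using (¬_)

-- Put Δ = (a - b)², so that f = (x - a)(x - b) has discriminant Δ, and gcd(n, a b Δ) = 1.
-- Multiplying out the chain gives f ≡ F₁ F₂ (mod n), where F₁ divides x^n - x and F₂
-- satisfies the Frobenius step.  As Δ is a square its Jacobi symbol is 1, so S is even,
-- i.e. deg F₂ ≤ 1.  If F₁ = f, every root r of f modulo n is a root of x^n - x.
-- Otherwise F₁ = x - u and F₂ = x - v with u^n ≡ u and v^n ≡ v; a root r of
-- f ≡ (x - u)(x - v) then satisfies r^n (r - v) ≡ r (r - v) and r^n (r - u) ≡ r (r - u),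
-- whence r^n (u - v) ≡ r (u - v), and since (a - b)² ≡ (u - v)², r^n Δ ≡ r Δ.
-- For r = a and r = b the factor r Δ is a unit modulo n and cancels, giving r^(n-1) ≡ 1.

private
  variable
    i k l n : ℕ
    t u v w x y z : ℤ

-- Unlike _≡_[mod_], a record is injective in x and y, so they can be inferred.
record _≋_[mod_] (x y : ℤ) (n : ℕ) : Set where
  constructor via
  field divides : + n Signed.∣ x - y

infix 4 _≋_[mod_]

≋⇒≡-mod : x ≋ y [mod n ] → x ≡ y [mod n ]
≋⇒≡-mod (via n∣x-y) = Signed.∣⇒∣ᵤ n∣x-y

≡-mod⇒≋ : x ≡ y [mod n ] → x ≋ y [mod n ]
≡-mod⇒≋ n∣x-y = via (Signed.∣ᵤ⇒∣ n∣x-y)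

≋-via : + n Signed.∣ z → z ≡ x - y → x ≋ y [mod n ]
≋-via n∣z refl = via n∣z

≋-reflexive : x ≡ y → x ≋ y [mod n ]
≋-reflexive {x = x} {n = n} refl =
  ≋-via (Signed.divides (+ 0) (sym (ℤ.*-zeroˡ (+ n)))) (sym (ℤ.+-inverseʳ x))

≋-refl : x ≋ x [mod n ]
≋-refl = ≋-reflexive refl

≋-sym : x ≋ y [mod n ] → y ≋ x [mod n ]
≋-sym {x = x} {y = y} (via n∣x-y) = ≋-via (Signed.∣m⇒∣-m n∣x-y) (negate x y)
  where
  negate : ∀ x y → - (x - y) ≡ y - x
  negate = solve-∀

≋-trans : x ≋ y [mod n ] → y ≋ z [mod n ] → x ≋ z [mod n ]
≋-trans {x = x} {y = y} {z = z} (via n∣x-y) (via n∣y-z) =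
  ≋-via (Signed.∣m∣n⇒∣m+n n∣x-y n∣y-z) (ℤ.+-minus-telescope x y z)

+-cong-≋ : x ≋ y [mod n ] → u ≋ v [mod n ] → x + u ≋ y + v [mod n ]
+-cong-≋ {x = x} {y = y} {u = u} {v = v} (via n∣x-y) (via n∣u-v) =
  ≋-via (Signed.∣m∣n⇒∣m+n n∣x-y n∣u-v) (regroup x y u v)
  where
  regroup : ∀ x y u v → (x - y) + (u - v) ≡ (x + u) - (y + v)
  regroup = solve-∀

-‿cong-≋ : x ≋ y [mod n ] → - x ≋ - y [mod n ]
-‿cong-≋ {x = x} {y = y} (via n∣x-y) =
  ≋-via (Signed.∣m⇒∣-m n∣x-y) (ℤ.neg-distrib-+ x (- y))

*-cong-≋ : x ≋ y [mod n ] → u ≋ v [mod n ] → x * u ≋ y * v [mod n ]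
*-cong-≋ {x = x} {y = y} {u = u} {v = v} (via n∣x-y) (via n∣u-v) =
  ≋-via (Signed.∣m∣n⇒∣m+n (Signed.∣m⇒∣m*n u n∣x-y) (Signed.∣n⇒∣m*n y n∣u-v))
        (regroup x y u v)
  where
  regroup : ∀ x y u v → (x - y) * u + y * (u - v) ≡ x * u - y * v
  regroup = solve-∀

*-congˡ-≋ : ∀ x → u ≋ v [mod n ] → x * u ≋ x * v [mod n ]
*-congˡ-≋ x = *-cong-≋ (≋-refl {x = x})

*-congʳ-≋ : ∀ x → u ≋ v [mod n ] → u * x ≋ v * x [mod n ]
*-congʳ-≋ x u≋v = *-cong-≋ u≋v (≋-refl {x = x})

+-congʳ-≋ : ∀ x → u ≋ v [mod n ] → u + x ≋ v + x [mod n ]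
+-congʳ-≋ x u≋v = +-cong-≋ u≋v (≋-refl {x = x})

-≋0⇒≋ : x - y ≋ + 0 [mod n ] → x ≋ y [mod n ]
-≋0⇒≋ {x = x} {y = y} (via n∣x-y-0) = ≋-via n∣x-y-0 (ℤ.+-identityʳ (x - y))

≋-nontrivial : 1 < n → ¬ (+ 0 ≋ + 1 [mod n ])
≋-nontrivial 1<n (via n∣-1) =
  ℕ.<-irrefl refl (subst (1 <_) (ℕ.∣1⇒≡1 (Signed.∣⇒∣ᵤ n∣-1)) 1<n)

≋-setoid : ℕ → Setoid 0ℓ 0ℓ
≋-setoid n = record
  { Carrier       = ℤ
  ; _≈_           = _≋_[mod n ]
  ; isEquivalence = record { refl = ≋-refl ; sym = ≋-sym ; trans = ≋-trans }
  }

module ≋-Reasoning (n : ℕ) = Relation.Binary.Reasoning.Setoid (≋-setoid n)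

coprime-∣ˡ : ∀ {m d} → d ℕ.∣ m → Coprime m k → Coprime d k
coprime-∣ˡ d∣m coprime (c∣d , c∣k) = coprime (ℕ.∣-trans c∣d d∣m , c∣k)

coprime-∣ʳ : ∀ {m d} → d ℕ.∣ m → Coprime n m → Coprime n d
coprime-∣ʳ d∣m coprime (c∣n , c∣d) = coprime (c∣n , ℕ.∣-trans c∣d d∣m)

coprime-*ʳ : ∀ x y → Coprime n ∣ x * y ∣ → Coprime n ∣ y ∣
coprime-*ʳ x y = coprime-∣ʳ (subst (_ ℕ.∣_) (sym (ℤ.abs-* x y)) (ℕ.n∣m*n ∣ x ∣))

*-cancelˡ-≋ : ∀ c {x y} → Coprime n ∣ c ∣ → c * x ≋ c * y [mod n ] → x ≋ y [mod n ]
*-cancelˡ-≋ {n = n} c {x} {y} coprime (via n∣cx-cy) =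
  ≡-mod⇒≋ {x = x} {y = y} (coprime-divisor coprime n∣∣c∣*∣x-y∣)
  where
  factor : ∀ c x y → c * x - c * y ≡ c * (x - y)
  factor = solve-∀
  n∣∣c∣*∣x-y∣ : n ℕ.∣ ∣ c ∣ ℕ.* ∣ x - y ∣
  n∣∣c∣*∣x-y∣ = subst (n ℕ.∣_) (trans (cong ∣_∣ (factor c x y)) (ℤ.abs-* c (x - y)))
                      (Signed.∣⇒∣ᵤ n∣cx-cy)

*-≋⇒^-*-≋ : x * w ≋ y * w [mod n ] → ∀ N → x ^ N * w ≋ y ^ N * w [mod n ]
*-≋⇒^-*-≋ xw≋yw zero = ≋-refl
*-≋⇒^-*-≋ {x = x} {w = w} {y = y} {n = n} xw≋yw (suc N) = begin
  x * x ^ N * w      ≡⟨ ℤ.*-assoc x (x ^ N) w ⟩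
  x * (x ^ N * w)    ≈⟨ *-congˡ-≋ x (*-≋⇒^-*-≋ {x = x} {w = w} {y = y} xw≋yw N) ⟩
  x * (y ^ N * w)    ≡⟨ x∙yz≈y∙xz x (y ^ N) w ⟩
  y ^ N * (x * w)    ≈⟨ *-congˡ-≋ (y ^ N) xw≋yw ⟩
  y ^ N * (y * w)    ≡⟨ x∙yz≈y∙xz (y ^ N) y w ⟩
  y * (y ^ N * w)    ≡⟨ ℤ.*-assoc y (y ^ N) w ⟨
  y * y ^ N * w      ∎
  where open ≋-Reasoning n

fermat-by-cancellation : ∀ {r w} m → Coprime n ∣ r * w ∣ →
                         r ^ suc m * w ≋ r * w [mod n ] → r ^ m ≋ + 1 [mod n ]
fermat-by-cancellation {n = n} {r} {w} m coprime rᵐ⁺¹w≋rw =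
  *-cancelˡ-≋ (r * w) coprime (begin
    r * w * r ^ m    ≡⟨ rearrange r w (r ^ m) ⟩
    r * r ^ m * w    ≈⟨ rᵐ⁺¹w≋rw ⟩
    r * w            ≡⟨ ℤ.*-identityʳ (r * w) ⟨
    r * w * + 1      ∎)
  where
  open ≋-Reasoning n
  rearrange : ∀ r w x → r * w * x ≡ r * x * w
  rearrange = solve-∀

root-^-≋ : ∀ N r u v → (r - u) * (r - v) ≋ + 0 [mod n ] → u ^ N ≋ u [mod n ] →
           r ^ N * (r - v) ≋ r * (r - v) [mod n ]
root-^-≋ {n = n} N r u v root uᴺ≋u = begin
  r ^ N * (r - v)   ≈⟨ *-≋⇒^-*-≋ {x = r} {w = r - v} {y = u} r≋u N ⟩
  u ^ N * (r - v)   ≈⟨ *-congʳ-≋ (r - v) uᴺ≋u ⟩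
  u * (r - v)       ≈⟨ r≋u ⟨
  r * (r - v)       ∎
  where
  open ≋-Reasoning n
  split : ∀ r u v → r * (r - v) ≡ (r - u) * (r - v) + u * (r - v)
  split = solve-∀
  r≋u : r * (r - v) ≋ u * (r - v) [mod n ]
  r≋u = begin
    r * (r - v)                      ≡⟨ split r u v ⟩
    (r - u) * (r - v) + u * (r - v)  ≈⟨ +-congʳ-≋ (u * (r - v)) root ⟩
    + 0 + u * (r - v)                ≡⟨ ℤ.+-identityˡ _ ⟩
    u * (r - v)                      ∎

-- For a monic quadratic q this is its discriminant, computed from q(0) and q(1).
discFromValues : ℤ → ℤ → ℤ
discFromValues q₀ q₁ = (q₀ - q₁ + + 1) * (q₀ - q₁ + + 1) - + 4 * q₀

discFromValues-cong : ∀ {p₀ p₁ q₀ q₁} → p₀ ≋ q₀ [mod n ] → p₁ ≋ q₁ [mod n ] →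
                      discFromValues p₀ p₁ ≋ discFromValues q₀ q₁ [mod n ]
discFromValues-cong {n = n} {p₀} {p₁} {q₀} {q₁} p₀≋q₀ p₁≋q₁ =
  +-cong-≋ (*-cong-≋ linear≋ linear≋) (-‿cong-≋ (*-congˡ-≋ (+ 4) p₀≋q₀))
  where
  linear≋ : p₀ - p₁ + + 1 ≋ q₀ - q₁ + + 1 [mod n ]
  linear≋ = +-congʳ-≋ (+ 1) (+-cong-≋ p₀≋q₀ (-‿cong-≋ p₁≋q₁))

discFromValues-roots : ∀ a b →
  discFromValues ((+ 0 - a) * (+ 0 - b)) ((+ 1 - a) * (+ 1 - b)) ≡ (a - b) * (a - b)
discFromValues-roots = expanded
  where
  expanded : ∀ a b → let q₀ = (+ 0 - a) * (+ 0 - b) ; q₁ = (+ 1 - a) * (+ 1 - b) in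
             (q₀ - q₁ + + 1) * (q₀ - q₁ + + 1) - + 4 * q₀ ≡ (a - b) * (a - b)
  expanded = solve-∀

quadratic-root-^-≋ : ∀ N a b u v r →
  (∀ t → (t - a) * (t - b) ≋ (t - u) * (t - v) [mod n ]) →
  u ^ N ≋ u [mod n ] → v ^ N ≋ v [mod n ] → (r - a) * (r - b) ≋ + 0 [mod n ] →
  r ^ N * ((a - b) * (a - b)) ≋ r * ((a - b) * (a - b)) [mod n ]
quadratic-root-^-≋ {n = n} N a b u v r same-values uᴺ≋u vᴺ≋v root = begin
  r ^ N * ((a - b) * (a - b))   ≈⟨ *-congˡ-≋ (r ^ N) disc≋ ⟩
  r ^ N * ((u - v) * (u - v))   ≡⟨ ℤ.*-assoc (r ^ N) _ _ ⟨
  r ^ N * (u - v) * (u - v)     ≈⟨ *-congʳ-≋ (u - v) rᴺ≋r ⟩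
  r * (u - v) * (u - v)         ≡⟨ ℤ.*-assoc r _ _ ⟩
  r * ((u - v) * (u - v))       ≈⟨ *-congˡ-≋ r disc≋ ⟨
  r * ((a - b) * (a - b))       ∎
  where
  open ≋-Reasoning n
  root-uv : (r - u) * (r - v) ≋ + 0 [mod n ]
  root-uv = ≋-trans (≋-sym (same-values r)) root
  root-vu : (r - v) * (r - u) ≋ + 0 [mod n ]
  root-vu = ≋-trans (≋-reflexive (ℤ.*-comm (r - v) (r - u))) root-uv
  disc≋ : (a - b) * (a - b) ≋ (u - v) * (u - v) [mod n ]
  disc≋ = begin
    (a - b) * (a - b)
      ≡⟨ discFromValues-roots a b ⟨
    discFromValues ((+ 0 - a) * (+ 0 - b)) ((+ 1 - a) * (+ 1 - b))
      ≈⟨ discFromValues-cong (same-values (+ 0)) (same-values (+ 1)) ⟩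
    discFromValues ((+ 0 - u) * (+ 0 - v)) ((+ 1 - u) * (+ 1 - v))
      ≡⟨ discFromValues-roots u v ⟩
    (u - v) * (u - v)
      ∎
  difference : ∀ x r u v → x * (u - v) ≡ x * (r - v) - x * (r - u)
  difference = solve-∀
  rᴺ≋r : r ^ N * (u - v) ≋ r * (u - v) [mod n ]
  rᴺ≋r = begin
    r ^ N * (u - v)                    ≡⟨ difference (r ^ N) r u v ⟩
    r ^ N * (r - v) - r ^ N * (r - u)  ≈⟨ +-cong-≋ (root-^-≋ N r u v root-uv uᴺ≋u)
                                                   (-‿cong-≋ (root-^-≋ N r v u root-vu vᴺ≋v)) ⟩
    r * (r - v) - r * (r - u)          ≡⟨ difference r r u v ⟨
    r * (u - v)                        ∎

eval : Poly → ℤ → ℤ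
eval []      t = + 0
eval (c ∷ p) t = c + t * eval p t

eval-const : ∀ c t → eval (c ∷ []) t ≡ c
eval-const c t = trans (cong (λ e → c + e) (ℤ.*-zeroʳ t)) (ℤ.+-identityʳ c)

eval-⊕ : ∀ p q t → eval (p ⊕ q) t ≡ eval p t + eval q t
eval-⊕ []      q       t = sym (ℤ.+-identityˡ _)
eval-⊕ (a ∷ p) []      t = sym (ℤ.+-identityʳ _)
eval-⊕ (a ∷ p) (b ∷ q) t = begin
  a + b + t * eval (p ⊕ q) t              ≡⟨ cong (λ e → a + b + t * e) (eval-⊕ p q t) ⟩
  a + b + t * (eval p t + eval q t)       ≡⟨ cong (λ e → a + b + e) (ℤ.*-distribˡ-+ t _ _) ⟩
  a + b + (t * eval p t + t * eval q t)   ≡⟨ interchange a b _ _ ⟩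
  a + t * eval p t + (b + t * eval q t)   ∎
  where open ≡-Reasoning

eval-· : ∀ c p t → eval (c · p) t ≡ c * eval p t
eval-· c []      t = sym (ℤ.*-zeroʳ c)
eval-· c (a ∷ p) t = begin
  c * a + t * eval (c · p) t   ≡⟨ cong (λ e → c * a + t * e) (eval-· c p t) ⟩
  c * a + t * (c * eval p t)   ≡⟨ cong (λ e → c * a + e) (x∙yz≈y∙xz t c _) ⟩
  c * a + c * (t * eval p t)   ≡⟨ ℤ.*-distribˡ-+ c a _ ⟨
  c * (a + t * eval p t)       ∎
  where open ≡-Reasoning

eval-⊛ : ∀ p q t → eval (p ⊛ q) t ≡ eval p t * eval q t
eval-⊛ []      q t = refl
eval-⊛ (a ∷ p) q t = begin
  eval (a · q ⊕ (+ 0 ∷ p ⊛ q)) t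
    ≡⟨ eval-⊕ (a · q) _ t ⟩
  eval (a · q) t + (+ 0 + t * eval (p ⊛ q) t)
    ≡⟨ cong₂ (λ x y → x + (+ 0 + t * y)) (eval-· a q t) (eval-⊛ p q t) ⟩
  a * eval q t + (+ 0 + t * (eval p t * eval q t))
    ≡⟨ horner-step a t (eval p t) (eval q t) ⟩
  (a + t * eval p t) * eval q t
    ∎
  where
  open ≡-Reasoning
  horner-step : ∀ a t x y → a * y + (+ 0 + t * (x * y)) ≡ (a + t * x) * y
  horner-step = solve-∀

eval-X^ : ∀ k t → eval (X^ k) t ≡ t ^ k
eval-X^ zero    t = eval-const (+ 1) t
eval-X^ (suc k) t = trans (ℤ.+-identityˡ _) (cong (t *_) (eval-X^ k t))

eval-X^-X : ∀ m t → eval (X^ m ⊕ ⊝ X^ 1) t ≡ t ^ m - t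
eval-X^-X m t = begin
  eval (X^ m ⊕ ⊝ X^ 1) t              ≡⟨ eval-⊕ (X^ m) (⊝ X^ 1) t ⟩
  eval (X^ m) t + eval (⊝ X^ 1) t     ≡⟨ cong₂ _+_ (eval-X^ m t) (eval-· (- + 1) (X^ 1) t) ⟩
  t ^ m + - + 1 * eval (X^ 1) t       ≡⟨ cong (λ x → t ^ m + - + 1 * x) (eval-X^ 1 t) ⟩
  t ^ m + - + 1 * t ^ 1               ≡⟨ cong (λ x → t ^ m + x) (ℤ.-1*i≡-i (t ^ 1)) ⟩
  t ^ m - t ^ 1                       ≡⟨ cong (λ x → t ^ m - x) (ℤ.^-identityʳ t) ⟩
  t ^ m - t                           ∎
  where open ≡-Reasoning

eval-∘P : ∀ p q t → eval (p ∘P q) t ≡ eval p (eval q t)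
eval-∘P []      q t = refl
eval-∘P (c ∷ p) q t = begin
  eval ((c ∷ []) ⊕ q ⊛ (p ∘P q)) t           ≡⟨ eval-⊕ (c ∷ []) (q ⊛ (p ∘P q)) t ⟩
  eval (c ∷ []) t + eval (q ⊛ (p ∘P q)) t    ≡⟨ cong₂ _+_ (eval-const c t) (eval-⊛ q _ t) ⟩
  c + eval q t * eval (p ∘P q) t             ≡⟨ cong (λ e → c + eval q t * e) (eval-∘P p q t) ⟩
  c + eval q t * eval p (eval q t)           ∎
  where open ≡-Reasoning

eval-linear : ∀ c t → eval (toPoly (c ∷ [])) t ≡ t - - c
eval-linear = expanded
  where
  expanded : ∀ c t → c + t * (+ 1 + t * + 0) ≡ t - - c
  expanded = solve-∀

eval-linProd : ∀ a b t → eval (toPoly (linProd a b)) t ≡ (t - a) * (t - b)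
eval-linProd = expanded
  where
  expanded : ∀ a b t → a * b + t * (- (a + b) + t * (+ 1 + t * + 0)) ≡ (t - a) * (t - b)
  expanded = solve-∀

disc₂-linProd : ∀ a b → disc₂ (linProd a b) ≡ (a - b) * (a - b)
disc₂-linProd = expanded
  where
  expanded : ∀ a b → - (a + b) * - (a + b) - + 4 * (a * b) ≡ (a - b) * (a - b)
  expanded = solve-∀

≈⇒coeff-≋ : ∀ p q → p ≈ q [modP n ] → ∀ k → coeff p k ≋ coeff q k [mod n ]
≈⇒coeff-≋ p q p≈q k = ≡-mod⇒≋ {x = coeff p k} {y = coeff q k} (p≈q k)

horner-cong : ∀ {c d} t → c ≋ d [mod n ] → x ≋ y [mod n ] → c + t * x ≋ d + t * y [mod n ]
horner-cong t c≋d x≋y = +-cong-≋ c≋d (*-congˡ-≋ t x≋y)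

eval-cong : ∀ p q → p ≈ q [modP n ] → ∀ t → eval p t ≋ eval q t [mod n ]
eval-cong []      []      p≈q t = ≋-refl
eval-cong []      (d ∷ q) p≈q t =
  ≋-trans (≋-reflexive (sym (eval-const (+ 0) t)))
          (horner-cong t (≈⇒coeff-≋ [] (d ∷ q) p≈q 0) (eval-cong [] q (p≈q ∘ suc) t))
eval-cong (c ∷ p) []      p≈q t =
  ≋-trans (horner-cong t (≈⇒coeff-≋ (c ∷ p) [] p≈q 0) (eval-cong p [] (p≈q ∘ suc) t))
          (≋-reflexive (eval-const (+ 0) t))
eval-cong (c ∷ p) (d ∷ q) p≈q t =
  horner-cong t (≈⇒coeff-≋ (c ∷ p) (d ∷ q) p≈q 0) (eval-cong p q (p≈q ∘ suc) t)

divisor-root : ∀ g s h → g ≈ s ⊛ h [modP n ] → eval h t ≋ + 0 [mod n ] → eval g t ≋ + 0 [mod n ]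
divisor-root {n = n} {t = t} g s h g≈sh h≋0 = begin
  eval g t             ≈⟨ eval-cong g (s ⊛ h) g≈sh t ⟩
  eval (s ⊛ h) t       ≡⟨ eval-⊛ s h t ⟩
  eval s t * eval h t  ≈⟨ *-congˡ-≋ (eval s t) h≋0 ⟩
  eval s t * + 0       ≡⟨ ℤ.*-zeroʳ (eval s t) ⟩
  + 0                  ∎
  where open ≋-Reasoning n

IsGCMD-rootˡ : ∀ g₁ g₂ h → IsGCMD n g₁ g₂ h →
               eval h t ≋ + 0 [mod n ] → eval g₁ t ≋ + 0 [mod n ]
IsGCMD-rootˡ g₁ _ h (_ , (s , g₁≈sh) , _) = divisor-root g₁ s h g₁≈sh

frobenius-root : ∀ F q m → F ∘P X^ m ≈ q ⊛ F [modP n ] →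
                 eval F t ≋ + 0 [mod n ] → eval F (t ^ m) ≋ + 0 [mod n ]
frobenius-root {t = t} F q m F∘Xᵐ≈qF F≋0 =
  ≋-trans (≋-reflexive (sym (trans (eval-∘P F (X^ m) t) (cong (eval F) (eval-X^ m t)))))
          (divisor-root (F ∘P X^ m) q F F∘Xᵐ≈qF F≋0)

coeff-⊕ : ∀ p q j → coeff (p ⊕ q) j ≡ coeff p j + coeff q j
coeff-⊕ []      q       j       = sym (ℤ.+-identityˡ _)
coeff-⊕ (a ∷ p) []      j       = sym (ℤ.+-identityʳ _)
coeff-⊕ (a ∷ p) (b ∷ q) zero    = refl
coeff-⊕ (a ∷ p) (b ∷ q) (suc j) = coeff-⊕ p q j

coeff-· : ∀ c p j → coeff (c · p) j ≡ c * coeff p j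
coeff-· c []      j       = sym (ℤ.*-zeroʳ c)
coeff-· c (a ∷ p) zero    = refl
coeff-· c (a ∷ p) (suc j) = coeff-· c p j

coeff-∷-⊛ : ∀ a p q j → coeff ((a ∷ p) ⊛ q) j ≡ a * coeff q j + coeff (+ 0 ∷ p ⊛ q) j
coeff-∷-⊛ a p q j =
  trans (coeff-⊕ (a · q) (+ 0 ∷ p ⊛ q) j) (cong (_+ coeff (+ 0 ∷ p ⊛ q) j) (coeff-· a q j))

coeff-∷-⊛-beyond : ∀ a p q {j} → (∀ {i} → l < i → coeff q i ≡ + 0) → l < j →
                   coeff ((a ∷ p) ⊛ q) j ≡ coeff (+ 0 ∷ p ⊛ q) j
coeff-∷-⊛-beyond a p q {j} q-above l<j = begin
  coeff ((a ∷ p) ⊛ q) j        ≡⟨ coeff-∷-⊛ a p q j ⟩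
  a * coeff q j + 0∷p⊛q[j]     ≡⟨ cong (λ x → a * x + 0∷p⊛q[j]) (q-above l<j) ⟩
  a * + 0 + 0∷p⊛q[j]           ≡⟨ cong (_+ 0∷p⊛q[j]) (ℤ.*-zeroʳ a) ⟩
  + 0 + 0∷p⊛q[j]               ≡⟨ ℤ.+-identityˡ _ ⟩
  0∷p⊛q[j]                     ∎
  where
  open ≡-Reasoning
  0∷p⊛q[j] : ℤ
  0∷p⊛q[j] = coeff (+ 0 ∷ p ⊛ q) j

IsZero : Poly → Set
IsZero p = ∀ j → coeff p j ≡ + 0

∷-isZero : ∀ {p} → IsZero p → IsZero (+ 0 ∷ p)
∷-isZero p≡0 zero    = refl
∷-isZero p≡0 (suc j) = p≡0 j

⊛-isZeroˡ : ∀ p q → IsZero p → IsZero (p ⊛ q)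
⊛-isZeroˡ []      q p≡0 j = refl
⊛-isZeroˡ (a ∷ p) q p≡0 j = begin
  coeff ((a ∷ p) ⊛ q) j                  ≡⟨ coeff-∷-⊛ a p q j ⟩
  a * coeff q j + coeff (+ 0 ∷ p ⊛ q) j
    ≡⟨ cong₂ (λ x y → x * coeff q j + y) (p≡0 0) (0∷p⊛q≡0 j) ⟩
  + 0                                    ∎
  where
  open ≡-Reasoning
  0∷p⊛q≡0 : IsZero (+ 0 ∷ p ⊛ q)
  0∷p⊛q≡0 = ∷-isZero (⊛-isZeroˡ p q (p≡0 ∘ suc))

-- Coefficient lists may carry trailing zeros, so being monic of degree k is a property
-- of the coefficients rather than of the length.
IsMonicOfDegree : Poly → ℕ → Set
IsMonicOfDegree p k = coeff p k ≡ + 1 × (∀ {j} → k < j → coeff p j ≡ + 0)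

toPoly-isMonic : (F : Monic k) → IsMonicOfDegree (toPoly F) k
toPoly-isMonic []      = refl , λ { {suc j} _ → refl }
toPoly-isMonic (c ∷ F) =
  proj₁ (toPoly-isMonic F) , λ { {suc j} (s<s k<j) → proj₂ (toPoly-isMonic F) k<j }

⊛-isMonic : ∀ p q → IsMonicOfDegree p k → IsMonicOfDegree q l → IsMonicOfDegree (p ⊛ q) (k ℕ.+ l)
⊛-isMonic []      q (() , _) _
⊛-isMonic {k = zero} {l = l} (a ∷ p) q (a≡1 , p≡0) (q-lead , q-above) = lead , above
  where
  0∷p⊛q≡0 : IsZero (+ 0 ∷ p ⊛ q)
  0∷p⊛q≡0 = ∷-isZero (⊛-isZeroˡ p q (λ j → p≡0 (z<s {j})))
  lead : coeff ((a ∷ p) ⊛ q) l ≡ + 1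
  lead = begin
    coeff ((a ∷ p) ⊛ q) l                    ≡⟨ coeff-∷-⊛ a p q l ⟩
    a * coeff q l + coeff (+ 0 ∷ p ⊛ q) l
      ≡⟨ cong₂ (λ x y → x * y + coeff (+ 0 ∷ p ⊛ q) l) a≡1 q-lead ⟩
    + 1 * + 1 + coeff (+ 0 ∷ p ⊛ q) l        ≡⟨ cong (λ x → + 1 + x) (0∷p⊛q≡0 l) ⟩
    + 1                                      ∎
    where open ≡-Reasoning
  above : ∀ {j} → l < j → coeff ((a ∷ p) ⊛ q) j ≡ + 0
  above {j} l<j = trans (coeff-∷-⊛-beyond a p q q-above l<j) (0∷p⊛q≡0 j)
⊛-isMonic {k = suc k} {l = l} (a ∷ p) q (lead , above) (q-lead , q-above) =
  trans (coeff-∷-⊛-beyond a p q q-above l<1+k+l) (proj₁ p⊛q-monic) ,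
  λ { {suc j} (s<s k+l<j) →
        trans (coeff-∷-⊛-beyond a p q q-above (ℕ.<-trans l<1+k+l (s<s k+l<j)))
              (proj₂ p⊛q-monic k+l<j) }
  where
  p⊛q-monic : IsMonicOfDegree (p ⊛ q) (k ℕ.+ l)
  p⊛q-monic = ⊛-isMonic p q (lead , above ∘ s<s) (q-lead , q-above)
  l<1+k+l : l < suc (k ℕ.+ l)
  l<1+k+l = s<s (ℕ.m≤n+m l k)

isMonic-degree-unique : 1 < n → ∀ p q → p ≈ q [modP n ] →
                        IsMonicOfDegree p k → IsMonicOfDegree q l → k ≡ l
isMonic-degree-unique {n = n} {k = k} {l = l} 1<n p q p≈q (p-lead , p-above) (q-lead , q-above)
  with ℕ.<-cmp k l
... | tri< k<l _ _ = ⊥-elim (≋-nontrivial 1<n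
        (subst₂ (_≋_[mod n ]) (p-above k<l) q-lead (≈⇒coeff-≋ p q p≈q l)))
... | tri≈ _ k≡l _ = k≡l
... | tri> _ _ l<k = ⊥-elim (≋-nontrivial 1<n
        (subst₂ (_≋_[mod n ]) (q-above l<k) p-lead (≋-sym (≈⇒coeff-≋ p q p≈q k))))

productAt : List MonicPoly → ℤ → ℤ
productAt []             t = + 1
productAt ((_ , F) ∷ Fs) t = eval (toPoly F) t * productAt Fs t

FactorChain⇒eval≋product : ∀ Fs (g : Monic k) → FactorChain n i k g Fs →
                           ∀ t → eval (toPoly g) t ≋ productAt Fs t [mod n ]
FactorChain⇒eval≋product []             []  refl t = ≋-reflexive (eval-const (+ 1) t)
FactorChain⇒eval≋product {n = n} ((_ , F) ∷ Fs) g (_ , _ , g′ , g≈Fg′ , chain) t = begin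
  eval (toPoly g) t
    ≈⟨ eval-cong (toPoly g) (toPoly F ⊛ toPoly g′) g≈Fg′ t ⟩
  eval (toPoly F ⊛ toPoly g′) t
    ≡⟨ eval-⊛ (toPoly F) (toPoly g′) t ⟩
  eval (toPoly F) t * eval (toPoly g′) t
    ≈⟨ *-congˡ-≋ (eval (toPoly F) t) (FactorChain⇒eval≋product Fs g′ chain t) ⟩
  eval (toPoly F) t * productAt Fs t
    ∎
  where open ≋-Reasoning n

FactorChain⇒degree≡sum : 1 < n → ∀ Fs (g : Monic k) → FactorChain n i k g Fs → k ≡ sum (map deg Fs)
FactorChain⇒degree≡sum 1<n []             [] refl = refl
FactorChain⇒degree≡sum 1<n ((m , F) ∷ Fs) g (_ , _ , g′ , g≈Fg′ , chain) =
  trans (isMonic-degree-unique 1<n (toPoly g) (toPoly F ⊛ toPoly g′) g≈Fg′ (toPoly-isMonic g)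
           (⊛-isMonic (toPoly F) (toPoly g′) (toPoly-isMonic F) (toPoly-isMonic g′)))
        (cong (m ℕ.+_) (FactorChain⇒degree≡sum 1<n Fs g′ chain))

jacobi-square : ∀ y {j} → Coprime n ∣ y * y ∣ → Jacobi (y * y) n j → j ≡ + 1
jacobi-square y coprime jac-one = refl
jacobi-square y coprime (jac-step p-prime _ (leg-zero p∣y²) _) =
  ⊥-elim (¬prime[1] (subst Prime (coprime (ℕ.m∣m*n _ , p∣y²)) p-prime))
jacobi-square y coprime (jac-step {p} _ _ (leg-res _ _) J) =
  trans (ℤ.*-identityˡ _) (jacobi-square y (coprime-∣ˡ (ℕ.n∣m*n p) coprime) J)
jacobi-square y coprime (jac-step _ _ (leg-non non-square) _) =
  ⊥-elim (non-square (y , ≋⇒≡-mod (≋-refl {x = y * y})))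

factorization-root-^ : ∀ a b {m₁ m₂} (F₁ : Monic m₁) (F₂ : Monic m₂) → m₁ ℕ.+ m₂ ≡ 2 →
  (∀ t → (t - a) * (t - b) ≋ productAt ((m₁ , F₁) ∷ (m₂ , F₂) ∷ []) t [mod n ]) →
  (∀ t → eval (toPoly F₁) t ≋ + 0 [mod n ] → t ^ n ≋ t [mod n ]) →
  (∀ t → eval (toPoly F₂) t ≋ + 0 [mod n ] → eval (toPoly F₂) (t ^ n) ≋ + 0 [mod n ]) →
  (- + 1) ^ Ssum 0 ((m₁ , F₁) ∷ (m₂ , F₂) ∷ []) ≡ + 1 →
  ∀ r → (r - a) * (r - b) ≋ + 0 [mod n ] →
  r ^ n * ((a - b) * (a - b)) ≋ r * ((a - b) * (a - b)) [mod n ]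
-- deg F₂ = 2 gives S = 1, so the Jacobi condition reads -1 ≡ 1.
factorization-root-^ a b [] F₂ refl _ _ _ ()
factorization-root-^ {n = n} a b (c₁ ∷ []) (c₂ ∷ []) refl factors fermat₁ frobenius₂ _ r root =
  quadratic-root-^-≋ n a b (- c₁) (- c₂) r same-values (fermat₁ (- c₁) (linear-root c₁)) v-fixed root
  where
  same-values : ∀ t → (t - a) * (t - b) ≋ (t - - c₁) * (t - - c₂) [mod n ]
  same-values t = ≋-trans (factors t)
    (≋-reflexive (cong₂ _*_ (eval-linear c₁ t) (trans (ℤ.*-identityʳ _) (eval-linear c₂ t))))
  linear-root : ∀ c → eval (toPoly (c ∷ [])) (- c) ≋ + 0 [mod n ]
  linear-root c = ≋-reflexive (trans (eval-linear c (- c)) (ℤ.+-inverseʳ (- c)))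
  v-fixed : (- c₂) ^ n ≋ - c₂ [mod n ]
  v-fixed = -≋0⇒≋ (≋-trans (≋-reflexive (sym (eval-linear c₂ ((- c₂) ^ n))))
                           (frobenius₂ (- c₂) (linear-root c₂)))
factorization-root-^ {n = n} a b F₁@(_ ∷ _ ∷ []) [] refl factors fermat₁ _ _ r root =
  *-congʳ-≋ ((a - b) * (a - b)) (fermat₁ r F₁-root)
  where
  F₁r : ℤ
  F₁r = eval (toPoly F₁) r
  F₁-root : F₁r ≋ + 0 [mod n ]
  F₁-root = begin
    F₁r                              ≡⟨ ℤ.*-identityʳ F₁r ⟨
    F₁r * + 1                        ≡⟨ cong (F₁r *_) (ℤ.*-identityʳ _) ⟨
    F₁r * (+ 1 * + 1)                ≡⟨ cong (λ e → F₁r * (e * + 1)) (eval-const (+ 1) r) ⟨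
    F₁r * (eval (+ 1 ∷ []) r * + 1)  ≈⟨ factors r ⟨
    (r - a) * (r - b)                ≈⟨ root ⟩
    + 0                              ∎
    where open ≋-Reasoning n
factorization-root-^ a b (_ ∷ _ ∷ _ ∷ _) _ ()

linProd-coprime : ∀ a b → gcd n ∣ coeff (toPoly (linProd a b)) 0 * disc₂ (linProd a b) ∣ ≡ 1 →
                  Coprime n ∣ a * b * ((a - b) * (a - b)) ∣
linProd-coprime a b gcd≡1 =
  subst (λ Δ → Coprime _ ∣ a * b * Δ ∣) (disc₂-linProd a b) (gcd≡1⇒coprime gcd≡1)

frobeniusProbablePrime⇒root-^ : ∀ a b n →
  FrobeniusProbablePrime 2 (linProd a b) (disc₂ (linProd a b)) n →
  ∀ r → (r - a) * (r - b) ≋ + 0 [mod n ] →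
  r ^ n * ((a - b) * (a - b)) ≋ r * ((a - b) * (a - b)) [mod n ]
frobeniusProbablePrime⇒root-^ a b n (_ , _ , _ , []            , () , _)
frobeniusProbablePrime⇒root-^ a b n (_ , _ , _ , _ ∷ []        , () , _)
frobeniusProbablePrime⇒root-^ a b n (_ , _ , _ , _ ∷ _ ∷ _ ∷ _ , () , _)
frobeniusProbablePrime⇒root-^ a b n
  (_ , 1<n , gcd≡1 , Fs@((m₁ , F₁) ∷ (m₂ , F₂) ∷ []) , refl , chain@(gcmd₁ , _) ,
   (_ , frobenius₂ , _) , jacobi) =
  factorization-root-^ a b F₁ F₂ degrees factors fermat₁ frobenius-step₂ jacobi≡1
  where
  f : Monic 2
  f = linProd a b
  degrees : m₁ ℕ.+ m₂ ≡ 2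
  degrees = sym (trans (FactorChain⇒degree≡sum {i = 1} 1<n Fs f chain)
                       (cong (m₁ ℕ.+_) (ℕ.+-identityʳ m₂)))
  factors : ∀ t → (t - a) * (t - b) ≋ productAt Fs t [mod n ]
  factors t = ≋-trans (≋-reflexive (sym (eval-linProd a b t)))
                      (FactorChain⇒eval≋product {i = 1} Fs f chain t)
  fermat₁ : ∀ t → eval (toPoly F₁) t ≋ + 0 [mod n ] → t ^ n ≋ t [mod n ]
  fermat₁ t F₁-root = -≋0⇒≋ (subst (λ e → t ^ e - t ≋ + 0 [mod n ]) (ℕ.^-identityʳ n)
    (≋-trans (≋-reflexive (sym (eval-X^-X (n ℕ.^ 1) t)))
             (IsGCMD-rootˡ _ (toPoly f) (toPoly F₁) gcmd₁ F₁-root)))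
  frobenius-step₂ : ∀ t → eval (toPoly F₂) t ≋ + 0 [mod n ] →
                    eval (toPoly F₂) (t ^ n) ≋ + 0 [mod n ]
  frobenius-step₂ t with frobenius₂ (ℕ.s≤s (ℕ.s≤s ℕ.z≤n))
  ... | q , F₂∘Xⁿ≈qF₂ = frobenius-root (toPoly F₂) q n F₂∘Xⁿ≈qF₂
  jacobi≡1 : (- + 1) ^ Ssum 0 Fs ≡ + 1
  jacobi≡1 = jacobi-square (a - b) (coprime-*ʳ (a * b) _ (linProd-coprime a b gcd≡1))
                           (subst (λ Δ → Jacobi Δ n _) (disc₂-linProd a b) jacobi)

theorem4p5 : (a b : ℤ) (n : ℕ) →
    FrobeniusPseudoprime 2 (linProd a b) (disc₂ (linProd a b)) n →
    Pseudoprime a n × Pseudoprime b n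
theorem4p5 a b zero (_ , _ , () , _)
theorem4p5 a b n@(suc m) (composite , frobenius@(_ , _ , gcd≡1 , _)) =
  (composite , ≋⇒≡-mod (fermat-by-cancellation m coprime-aΔ (root-^ a a-root))) ,
  (composite , ≋⇒≡-mod (fermat-by-cancellation m coprime-bΔ (root-^ b b-root)))
  where
  Δ : ℤ
  Δ = (a - b) * (a - b)
  root-^ : ∀ r → (r - a) * (r - b) ≋ + 0 [mod n ] → r ^ n * Δ ≋ r * Δ [mod n ]
  root-^ = frobeniusProbablePrime⇒root-^ a b n frobenius
  coprime-abΔ : Coprime n ∣ a * b * Δ ∣
  coprime-abΔ = linProd-coprime a b gcd≡1
  swap : ∀ a b Δ → a * b * Δ ≡ b * (a * Δ)
  swap = solve-∀
  coprime-aΔ : Coprime n ∣ a * Δ ∣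
  coprime-aΔ = coprime-*ʳ b (a * Δ) (subst (λ x → Coprime n ∣ x ∣) (swap a b Δ) coprime-abΔ)
  coprime-bΔ : Coprime n ∣ b * Δ ∣
  coprime-bΔ = coprime-*ʳ a (b * Δ) (subst (λ x → Coprime n ∣ x ∣) (ℤ.*-assoc a b Δ) coprime-abΔ)
  a-root : (a - a) * (a - b) ≋ + 0 [mod n ]
  a-root = ≋-reflexive (cong (_* (a - b)) (ℤ.+-inverseʳ a))
  b-root : (b - a) * (b - b) ≋ + 0 [mod n ]
  b-root = ≋-reflexive (trans (cong ((b - a) *_) (ℤ.+-inverseʳ b)) (ℤ.*-zeroʳ (b - a)))
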